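{- Let $p \geqslant 2$ be an integer. Every sentence true in the standard model $(\mathbb N, S, +, 0, V_p)$ is a consequence of $\mathsf{T_{BA}}_p$, i.e. $\mathsf{T_{BA}}_p \vDash \mathsf{BA}_p$; in particular $\mathsf{T_{BA}}_p$ is complete.
   Context: Fix an integer $p \geqslant 2$. The language consists of a constant $0$, a unary function symbol $S$, a binary function symbol $+$ and a unary function symbol $V_p$. In the standard model $(\mathbb N, S, +, 0, V_p)$, $S(n)=n+1$, $+$ is addition, $V_p(0)=0$ and, for $n>0$, $V_p(n)=p^k$ where $p^k \mid n$ and $p^{k+1}\nmid n$. $\mathsf{BA}_p$ denotes the complete first-order theory of this standard model. For $n\in\mathbb N$, $\underline n$ denotes the numeral $S^n(0)$; for a positive integer $n$ and a term $t$, $n t$ denotes the term $(\dots((t+t)+t)\dots)$ with $n$ occurrences of $t$. Iterated exponentials are defined by $2^k_0=k$, $2^k_{m+1}=2^{2^k_m}$. For a formula $\varphi$, $|\varphi|$ is its length (number of symbols). $x \leqslant y$ abbreviates $\exists z\,(x+z=y)$ for a fresh variable $z$, and $\exists x \leqslant t\, \varphi$ abbreviates $\exists x\,(x\leqslant t \wedge \varphi)$. The theory $\mathsf{T_{BA}}_p$ consists of the (universal closures of the) axioms: (S0) $Sx=Sy\to x=y$; (S1) $0\ne Sx$; (S2) $x=0\vee\exists y\,(x=Sy)$; (A0) $x+0=x$; (A1) $x+Sy=S(x+y)$; (V0) $V_p(0)=0$; (V1) $V_p(\underline 1)=\underline 1$; (V2) $V_p(p x)=p V_p(x)$; (V3)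 $\bigwedge_{i=1}^{p-1} V_p(p x+\underline i)=\underline 1$; and, for each formula $\varphi(x)$ with exactly one free variable, (Bound$_\varphi$) $\exists x\,\varphi(x)\to\exists x\leqslant \underline{n_\varphi}\,\varphi(x)$, where $n_\varphi=p^{2^3_{|\varphi|}}$. -}

module Defs where

open import Data.Nat using (ℕ; zero; suc; _+_; _*_; _∸_; _^_; _≤_; _⊔_; _≡ᵇ_; NonZero; >-nonZero; s≤s; z≤n)
open import Data.Nat.DivMod using (_/_; _%_)
open import Data.Nat.Properties using (_≟_; ≤-trans)
open import Data.Bool using (Bool; true; false; if_then_else_; _∨_)
open import Data.List using (List; []; _∷_; applyUpTo)
open import Data.Product using (Σ; _×_)
open import Data.Sum using (_⊎_)
open import Data.Empty using (⊥)
open import Relation.Nullary using (¬_; yes; no)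
open import Relation.Binary.PropositionalEquality using (_≡_)

data Term : Set where
  var  : ℕ → Term
  zer  : Term
  S    : Term → Term
  _⊕_  : Term → Term → Term
  V    : Term → Term

data Formula : Set where
  _≐_   : Term → Term → Formula
  ¬'_   : Formula → Formula
  _∧'_  : Formula → Formula → Formula
  _∨'_  : Formula → Formula → Formula
  _⇒'_  : Formula → Formula → Formula
  ∀'    : ℕ → Formula → Formula
  ∃'    : ℕ → Formula → Formula

num : ℕ → Term
num zero    = zer
num (suc n) = S (num n)

-- rep n t  is the term (n+1) t = (…((t+t)+t)…) with n+1 occurrences of t
rep : ℕ → Term → Term
rep zero    t = t
rep (suc n) t = rep n t ⊕ t

-- n t  for positive n
times : ℕ → Term → Term
times n t = rep (n ∸ 1) t

-- length (number of symbols), counting parentheses around binary terms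
-- and binary connectives
lenT : Term → ℕ
lenT (var _) = 1
lenT zer     = 1
lenT (S t)   = 1 + lenT t
lenT (t ⊕ u) = 3 + lenT t + lenT u
lenT (V t)   = 3 + lenT t

len : Formula → ℕ
len (t ≐ u)  = 1 + lenT t + lenT u
len (¬' φ)   = 1 + len φ
len (φ ∧' ψ) = 3 + len φ + len ψ
len (φ ∨' ψ) = 3 + len φ + len ψ
len (φ ⇒' ψ) = 3 + len φ + len ψ
len (∀' _ φ) = 2 + len φ
len (∃' _ φ) = 2 + len φ

freeT : ℕ → Term → Bool
freeT x (var y) = x ≡ᵇ y
freeT x zer     = false
freeT x (S t)   = freeT x t
freeT x (t ⊕ u) = freeT x t ∨ freeT x u
freeT x (V t)   = freeT x t

free : ℕ → Formula → Bool
free x (t ≐ u)  = freeT x t ∨ freeT x u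
free x (¬' φ)   = free x φ
free x (φ ∧' ψ) = free x φ ∨ free x ψ
free x (φ ∨' ψ) = free x φ ∨ free x ψ
free x (φ ⇒' ψ) = free x φ ∨ free x ψ
free x (∀' y φ) = if x ≡ᵇ y then false else free x φ
free x (∃' y φ) = if x ≡ᵇ y then false else free x φ

Sentence : Formula → Set
Sentence φ = ∀ y → free y φ ≡ false

OneFree : ℕ → Formula → Set
OneFree x φ = free x φ ≡ true × (∀ y → free y φ ≡ true → y ≡ x)

maxVarT : Term → ℕ
maxVarT (var y) = y
maxVarT zer     = 0
maxVarT (S t)   = maxVarT t
maxVarT (t ⊕ u) = maxVarT t ⊔ maxVarT u
maxVarT (V t)   = maxVarT t

maxVar : Formula → ℕ
maxVar (t ≐ u)  = maxVarT t ⊔ maxVarT u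
maxVar (¬' φ)   = maxVar φ
maxVar (φ ∧' ψ) = maxVar φ ⊔ maxVar ψ
maxVar (φ ∨' ψ) = maxVar φ ⊔ maxVar ψ
maxVar (φ ⇒' ψ) = maxVar φ ⊔ maxVar ψ
maxVar (∀' y φ) = y ⊔ maxVar φ
maxVar (∃' y φ) = y ⊔ maxVar φ

-- x ≤ t  :=  ∃ z (x + z = t), z fresh (given explicitly)
leq : ℕ → ℕ → Term → Formula
leq z x t = ∃' z ((var x ⊕ var z) ≐ t)

existsLeq : ℕ → ℕ → Term → Formula → Formula
existsLeq z x t φ = ∃' x (leq z x t ∧' φ)

tower : ℕ → ℕ → ℕ
tower k zero    = k
tower k (suc m) = 2 ^ tower k m

nBound : ℕ → Formula → ℕ
nBound p φ = p ^ tower 3 (len φ)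

-- big conjunction of a nonempty list (the empty case never arises for p ≥ 2)
⋀ : List Formula → Formula
⋀ []           = zer ≐ zer
⋀ (φ ∷ [])     = φ
⋀ (φ ∷ ψ ∷ ψs) = φ ∧' ⋀ (ψ ∷ ψs)

module _ where
  private
    x y : Term
    x = var 0
    y = var 1

  data Ax (p : ℕ) : Formula → Set where
    S0 : Ax p ((S x ≐ S y) ⇒' (x ≐ y))
    S1 : Ax p (¬' (zer ≐ S x))
    S2 : Ax p ((x ≐ zer) ∨' ∃' 1 (x ≐ S y))
    A0 : Ax p ((x ⊕ zer) ≐ x)
    A1 : Ax p ((x ⊕ S y) ≐ S (x ⊕ y))
    V0 : Ax p (V zer ≐ zer)
    V1 : Ax p (V (num 1) ≐ num 1)
    V2 : Ax p (V (times p x) ≐ times p (V x))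
    V3 : Ax p (⋀ (applyUpTo (λ j → V (times p x ⊕ num (suc j)) ≐ num 1) (p ∸ 1)))
    Bound : (φ : Formula) (v : ℕ) → OneFree v φ →
            Ax p (∃' v φ ⇒' existsLeq (suc (v ⊔ maxVar φ)) v (num (nBound p φ)) φ)

record Structure : Set₁ where
  field
    Carrier : Set
    z₀      : Carrier
    s       : Carrier → Carrier
    add     : Carrier → Carrier → Carrier
    vp      : Carrier → Carrier

module _ (M : Structure) where
  open Structure M

  Assignment : Set
  Assignment = ℕ → Carrier

  _[_↦_] : Assignment → ℕ → Carrier → Assignment
  (ρ [ x ↦ a ]) y = if y ≡ᵇ x then a else ρ y

  evalT : Assignment → Term → Carrier
  evalT ρ (var x) = ρ x
  evalT ρ zer     = z₀
  evalT ρ (S t)   = s (evalT ρ t)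
  evalT ρ (t ⊕ u) = add (evalT ρ t) (evalT ρ u)
  evalT ρ (V t)   = vp (evalT ρ t)

  Sat : Assignment → Formula → Set
  Sat ρ (t ≐ u)  = evalT ρ t ≡ evalT ρ u
  Sat ρ (¬' φ)   = ¬ Sat ρ φ
  Sat ρ (φ ∧' ψ) = Sat ρ φ × Sat ρ ψ
  Sat ρ (φ ∨' ψ) = Sat ρ φ ⊎ Sat ρ ψ
  Sat ρ (φ ⇒' ψ) = Sat ρ φ → Sat ρ ψ
  Sat ρ (∀' x φ) = (a : Carrier) → Sat (ρ [ x ↦ a ]) φ
  Sat ρ (∃' x φ) = Σ Carrier λ a → Sat (ρ [ x ↦ a ]) φ

  _⊨_ : Formula → Set
  _⊨_ φ = ∀ ρ → Sat ρ φ

ModelOfTBA : ℕ → Structure → Set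
ModelOfTBA p M = ∀ φ → Ax p φ → _⊨_ M φ

-- vpF p fuel n : p^k for the largest k with p^k ∣ n (for n > 0, enough fuel)
vpF : (p : ℕ) → .{{NonZero p}} → ℕ → ℕ → ℕ
vpF p zero    n = 1
vpF p (suc f) n with n % p ≟ 0
... | yes _ = p * vpF p f (n / p)
... | no  _ = 1

Vp : (p : ℕ) → .{{NonZero p}} → ℕ → ℕ
Vp p zero    = 0
Vp p (suc n) = vpF p (suc n) (suc n)

Std : (p : ℕ) → 2 ≤ p → Structure
Std p hp = record
  { Carrier = ℕ ; z₀ = 0 ; s = suc ; add = _+_
  ; vp = Vp p {{>-nonZero (≤-trans (s≤s z≤n) hp)}} }

{-# OPTIONS --safe #-}
module Submission where

-- Every model M of T_BA_p contains the numerals, on which it agrees with the standard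
-- model: the axioms S0–A1 make the numerals an initial segment of M closed under +, and
-- V0–V3 compute V_p on them by p-adic induction.  The Bound schema says that a
-- satisfiable formula with one free variable has a witness below a numeral, hence a
-- numeral witness.  Substituting numerals for the other variables, this is exactly the
-- Tarski–Vaught test, so the numerals form an elementary substructure isomorphic to ℕ,
-- and M satisfies every sentence true in ℕ.

open import Defs
open import Level using (0ℓ)
open import Axiom.ExcludedMiddle using (ExcludedMiddle)
open import Axiom.DoubleNegationElimination using (DoubleNegationElimination; em⇒dne)
open import Data.Nat
  using (ℕ; zero; suc; _+_; _*_; _≤_; _<_; _≡ᵇ_; _⊔_; s≤s; z≤n; s≤s⁻¹; >-nonZero)
open import Data.Nat.Properties
open import Data.Nat.DivMod
open import Data.Nat.Induction using (<-rec)
open import Data.Fin using (Fin; toℕ)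
open import Data.Fin.Properties using (toℕ<n)
open import Data.Bool using (Bool; true; false; T; if_then_else_; _∨_)
open import Data.Bool.Properties using (T-∨; T-≡)
open import Data.Maybe using (Maybe; just; nothing; maybe′)
open import Data.List using (applyUpTo)
open import Data.Product using (Σ; _,_; proj₁)
open import Data.Product.Function.NonDependent.Propositional using (_×-⇔_)
import Data.Product.Function.Dependent.Propositional as Σ
open import Data.Sum using (_⊎_; inj₁; inj₂; [_,_]′)
open import Data.Sum.Function.Propositional using (_⊎-⇔_)
open import Data.Empty using (⊥-elim)
open import Function using (id; _∘_; const; _⇔_; mk⇔; Equivalence)
open import Function.Construct.Composition using (_⇔-∘_)
open import Function.Construct.Identity using (⇔-id)
open import Function.Related.TypeIsomorphisms using (→-cong-⇔; ¬-cong-⇔)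
open import Relation.Nullary using (yes; no)
open import Relation.Binary.PropositionalEquality

open Equivalence using (to; from)

∀-cong-⇔ : {A : Set} {B C : A → Set} →
           (∀ a → B a ⇔ C a) → ((a : A) → B a) ⇔ ((a : A) → C a)
∀-cong-⇔ B⇔C = mk⇔ (λ f a → to (B⇔C a) (f a)) (λ g a → from (B⇔C a) (g a))

T-∨ˡ : ∀ {a b} → T a → T (a ∨ b)
T-∨ˡ = from T-∨ ∘ inj₁

T-∨ʳ : ∀ {a b} → T b → T (a ∨ b)
T-∨ʳ = from T-∨ ∘ inj₂

-- Definitionally the update `_[_↦_]` of Defs, but at an arbitrary codomain.
_[_≔_] : {A : Set} → (ℕ → A) → ℕ → A → ℕ → A
(ρ [ x ≔ a ]) y = if y ≡ᵇ x then a else ρ y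

module _ {A : Set} (ρ : ℕ → A) where

  update-same : ∀ x a → (ρ [ x ≔ a ]) x ≡ a
  update-same x a with x ≡ᵇ x | ≡⇒≡ᵇ x x refl
  ... | true | _ = refl

  update-other : ∀ {x y} a → y ≢ x → (ρ [ x ≔ a ]) y ≡ ρ y
  update-other {x} {y} a y≢x with y ≡ᵇ x | ≡ᵇ⇒≡ y x
  ... | true  | y≡x = ⊥-elim (y≢x (y≡x _))
  ... | false | _   = refl

  update-agree : ∀ {ρ' : ℕ → A} x a (P : ℕ → Bool) →
                 (∀ y → T (if y ≡ᵇ x then false else P y) → ρ y ≡ ρ' y) →
                 ∀ y → T (P y) → (ρ [ x ≔ a ]) y ≡ (ρ' [ x ≔ a ]) y
  update-agree x a P agree y Py with y ≡ᵇ x | agree y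
  ... | true  | _       = refl
  ... | false | agree-y = agree-y Py

numeral-closed : ∀ y n → freeT y (num n) ≡ false
numeral-closed y zero    = refl
numeral-closed y (suc n) = numeral-closed y n

-- Simultaneous substitution of numerals; `nothing` leaves a variable in place.
substT : (ℕ → Maybe ℕ) → Term → Term
substT f (var y) = maybe′ num (var y) (f y)
substT f zer     = zer
substT f (S t)   = S (substT f t)
substT f (t ⊕ u) = substT f t ⊕ substT f u
substT f (V t)   = V (substT f t)

sub : (ℕ → Maybe ℕ) → Formula → Formula
sub f (t ≐ u)  = substT f t ≐ substT f u
sub f (¬' φ)   = ¬' sub f φ
sub f (φ ∧' ψ) = sub f φ ∧' sub f ψ
sub f (φ ∨' ψ) = sub f φ ∨' sub f ψ
sub f (φ ⇒' ψ) = sub f φ ⇒' sub f ψ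
sub f (∀' x φ) = ∀' x (sub (f [ x ≔ nothing ]) φ)
sub f (∃' x φ) = ∃' x (sub (f [ x ≔ nothing ]) φ)

free-substT : ∀ f t y → T (freeT y (substT f t)) → f y ≡ nothing
free-substT f (var z) y y∈t with f z in fz
... | just n  = ⊥-elim (subst T (numeral-closed y n) y∈t)
... | nothing = subst (λ w → f w ≡ nothing) (sym (≡ᵇ⇒≡ y z y∈t)) fz
free-substT f (S t)   y y∈t = free-substT f t y y∈t
free-substT f (V t)   y y∈t = free-substT f t y y∈t
free-substT f (t ⊕ u) y y∈t =
  [ free-substT f t y , free-substT f u y ]′ (to T-∨ y∈t)

free-sub : ∀ φ f y → T (free y (sub f φ)) → f y ≡ nothing
free-sub (t ≐ u)  f y y∈φ = [ free-substT f t y , free-substT f u y ]′ (to T-∨ y∈φ)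
free-sub (¬' φ)   f y y∈φ = free-sub φ f y y∈φ
free-sub (φ ∧' ψ) f y y∈φ = [ free-sub φ f y , free-sub ψ f y ]′ (to T-∨ y∈φ)
free-sub (φ ∨' ψ) f y y∈φ = [ free-sub φ f y , free-sub ψ f y ]′ (to T-∨ y∈φ)
free-sub (φ ⇒' ψ) f y y∈φ = [ free-sub φ f y , free-sub ψ f y ]′ (to T-∨ y∈φ)
free-sub (∀' x φ) f y y∈φ with y ≡ᵇ x | free-sub φ (f [ x ≔ nothing ]) y
... | false | ih = ih y∈φ
free-sub (∃' x φ) f y y∈φ with y ≡ᵇ x | free-sub φ (f [ x ≔ nothing ]) y
... | false | ih = ih y∈φ

closeBut : ℕ → (ℕ → ℕ) → ℕ → Maybe ℕ
closeBut x σ y = if y ≡ᵇ x then nothing else just (σ y)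

closeBut-nothing : ∀ x σ y → closeBut x σ y ≡ nothing → y ≡ x
closeBut-nothing x σ y with y ≡ᵇ x | ≡ᵇ⇒≡ y x
... | true | y≡x = λ _ → y≡x _

-- The conjunct x ≐ x keeps x free even when it does not occur in φ.
isolate : ℕ → (ℕ → ℕ) → Formula → Formula
isolate x σ φ = sub (closeBut x σ) φ ∧' (var x ≐ var x)

oneFree-isolate : ∀ φ x σ → OneFree x (isolate x σ φ)
oneFree-isolate φ x σ =
  to T-≡ (T-∨ʳ {free x (sub (closeBut x σ) φ)} (T-∨ˡ (≡⇒≡ᵇ x x refl))) , only-x
  where
  only-x : ∀ y → free y (isolate x σ φ) ≡ true → y ≡ x
  only-x y y∈ψ = [ closeBut-nothing x σ y ∘ free-sub φ (closeBut x σ) y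
                 , ≡ᵇ⇒≡ y x ∘ [ id , id ]′ ∘ to T-∨
                 ]′ (to T-∨ (from T-≡ y∈ψ))

module Semantics (M : Structure) where
  open Structure M

  numeral : ℕ → Carrier
  numeral zero    = z₀
  numeral (suc n) = s (numeral n)

  eval-num : ∀ ρ n → evalT M ρ (num n) ≡ numeral n
  eval-num ρ zero    = refl
  eval-num ρ (suc n) = cong s (eval-num ρ n)

  evalT-coincidence : ∀ t {ρ ρ'} → (∀ y → T (freeT y t) → ρ y ≡ ρ' y) →
                      evalT M ρ t ≡ evalT M ρ' t
  evalT-coincidence (var x) agree = agree x (≡⇒≡ᵇ x x refl)
  evalT-coincidence zer     agree = refl
  evalT-coincidence (S t)   agree = cong s (evalT-coincidence t agree)
  evalT-coincidence (V t)   agree = cong vp (evalT-coincidence t agree)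
  evalT-coincidence (t ⊕ u) agree =
    cong₂ add (evalT-coincidence t (λ y → agree y ∘ T-∨ˡ))
              (evalT-coincidence u (λ y → agree y ∘ T-∨ʳ))

  sat-coincidence : ∀ φ {ρ ρ'} → (∀ y → T (free y φ) → ρ y ≡ ρ' y) →
                    Sat M ρ φ ⇔ Sat M ρ' φ
  sat-coincidence (t ≐ u) agree
    rewrite evalT-coincidence t (λ y → agree y ∘ T-∨ˡ)
          | evalT-coincidence u (λ y → agree y ∘ T-∨ʳ) = ⇔-id _
  sat-coincidence (¬' φ)   agree = ¬-cong-⇔ (sat-coincidence φ agree)
  sat-coincidence (φ ∧' ψ) agree =
    sat-coincidence φ (λ y → agree y ∘ T-∨ˡ) ×-⇔ sat-coincidence ψ (λ y → agree y ∘ T-∨ʳ)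
  sat-coincidence (φ ∨' ψ) agree =
    sat-coincidence φ (λ y → agree y ∘ T-∨ˡ) ⊎-⇔ sat-coincidence ψ (λ y → agree y ∘ T-∨ʳ)
  sat-coincidence (φ ⇒' ψ) agree =
    →-cong-⇔ (sat-coincidence φ (λ y → agree y ∘ T-∨ˡ))
             (sat-coincidence ψ (λ y → agree y ∘ T-∨ʳ))
  sat-coincidence (∀' x φ) {ρ} agree =
    ∀-cong-⇔ λ a → sat-coincidence φ (update-agree ρ x a (λ y → free y φ) agree)
  sat-coincidence (∃' x φ) {ρ} agree =
    Σ.congˡ λ {a} → sat-coincidence φ (update-agree ρ x a (λ y → free y φ) agree)

  sat-≗ : ∀ φ {ρ ρ'} → ρ ≗ ρ' → Sat M ρ φ ⇔ Sat M ρ' φ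
  sat-≗ φ ρ≗ρ' = sat-coincidence φ (λ y _ → ρ≗ρ' y)

  sentence-sat : ∀ φ → Sentence φ → ∀ {ρ} ρ' → Sat M ρ φ → Sat M ρ' φ
  sentence-sat φ closed ρ' = to (sat-coincidence φ (λ y y∈φ → ⊥-elim (subst T (closed y) y∈φ)))

  _⊲_ : Assignment M → (ℕ → Maybe ℕ) → Assignment M
  (ρ ⊲ f) y = maybe′ numeral (ρ y) (f y)

  eval-substT : ∀ t ρ f → evalT M ρ (substT f t) ≡ evalT M (ρ ⊲ f) t
  eval-substT (var y) ρ f with f y
  ... | just n  = eval-num ρ n
  ... | nothing = refl
  eval-substT zer     ρ f = refl
  eval-substT (S t)   ρ f = cong s (eval-substT t ρ f)
  eval-substT (t ⊕ u) ρ f = cong₂ add (eval-substT t ρ f) (eval-substT u ρ f)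
  eval-substT (V t)   ρ f = cong vp (eval-substT t ρ f)

  ⊲-update : ∀ ρ f x a → ((ρ [ x ≔ a ]) ⊲ (f [ x ≔ nothing ])) ≗ ((ρ ⊲ f) [ x ≔ a ])
  ⊲-update ρ f x a y with y ≡ᵇ x
  ... | true  = refl
  ... | false = refl

  sat-sub : ∀ φ ρ f → Sat M ρ (sub f φ) ⇔ Sat M (ρ ⊲ f) φ
  sat-sub (t ≐ u)  ρ f rewrite eval-substT t ρ f | eval-substT u ρ f = ⇔-id _
  sat-sub (¬' φ)   ρ f = ¬-cong-⇔ (sat-sub φ ρ f)
  sat-sub (φ ∧' ψ) ρ f = sat-sub φ ρ f ×-⇔ sat-sub ψ ρ f
  sat-sub (φ ∨' ψ) ρ f = sat-sub φ ρ f ⊎-⇔ sat-sub ψ ρ f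
  sat-sub (φ ⇒' ψ) ρ f = →-cong-⇔ (sat-sub φ ρ f) (sat-sub ψ ρ f)
  sat-sub (∀' x φ) ρ f = ∀-cong-⇔ λ a →
    sat-≗ φ (⊲-update ρ f x a) ⇔-∘ sat-sub φ (ρ [ x ≔ a ]) (f [ x ≔ nothing ])
  sat-sub (∃' x φ) ρ f = Σ.congˡ λ {a} →
    sat-≗ φ (⊲-update ρ f x a) ⇔-∘ sat-sub φ (ρ [ x ≔ a ]) (f [ x ≔ nothing ])

  sat-closeBut : ∀ φ x σ {ρ} a → ρ ≗ numeral ∘ σ →
                 Sat M (ρ [ x ≔ a ]) (sub (closeBut x σ) φ) ⇔ Sat M (ρ [ x ≔ a ]) φ
  sat-closeBut φ x σ {ρ} a ρ≗σ = sat-≗ φ agree ⇔-∘ sat-sub φ (ρ [ x ≔ a ]) (closeBut x σ)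
    where
    agree : ((ρ [ x ≔ a ]) ⊲ closeBut x σ) ≗ (ρ [ x ≔ a ])
    agree y with y ≡ᵇ x
    ... | true  = refl
    ... | false = sym (ρ≗σ y)

  sat-⋀-applyUpTo : ∀ (f : ℕ → Formula) n {ρ j} → j < n →
                    Sat M ρ (⋀ (applyUpTo f n)) → Sat M ρ (f j)
  sat-⋀-applyUpTo f (suc zero)    {j = zero}  _         φ₀   = φ₀
  sat-⋀-applyUpTo f (suc (suc n)) {j = zero}  _         φ₀⋯  = proj₁ φ₀⋯
  sat-⋀-applyUpTo f (suc (suc n)) {j = suc j} (s≤s j<n) (_ , φ₁⋯) =
    sat-⋀-applyUpTo (f ∘ suc) (suc n) j<n φ₁⋯
  sat-⋀-applyUpTo f (suc zero)    {j = suc j} (s≤s ())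

module StandardVp (p' : ℕ) where
  p : ℕ
  p = suc (suc p')

  vpF-divisible : ∀ f n → n % p ≡ 0 → vpF p (suc f) n ≡ p * vpF p f (n / p)
  vpF-divisible f n p∣n with n % p ≟ 0
  ... | yes _  = refl
  ... | no p∤n = ⊥-elim (p∤n p∣n)

  vpF-indivisible : ∀ f n → n % p ≢ 0 → vpF p (suc f) n ≡ 1
  vpF-indivisible f n p∤n with n % p ≟ 0
  ... | yes p∣n = ⊥-elim (p∤n p∣n)
  ... | no _    = refl

  1<p : 1 < p
  1<p = s≤s (s≤s z≤n)

  quotient-positive : ∀ n → 1 ≤ n → n % p ≡ 0 → 1 ≤ n / p
  quotient-positive n 1≤n p∣n with n <? p
  ... | no  n≮p = m≥n⇒m/n>0 (≮⇒≥ n≮p)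
  ... | yes n<p = ⊥-elim (<⇒≢ 1≤n (sym (trans (sym (m<n⇒m%n≡m n<p)) p∣n)))

  vpF-fuel : ∀ f g n → 1 ≤ n → n ≤ f → n ≤ g → vpF p f n ≡ vpF p g n
  vpF-fuel (suc f) (suc g) n 1≤n n≤1+f n≤1+g with n % p ≟ 0
  ... | no _    = refl
  ... | yes p∣n = cong (p *_)
    (vpF-fuel f g (n / p) (quotient-positive n 1≤n p∣n) (quotient≤ n≤1+f) (quotient≤ n≤1+g))
    where
    quotient≤ : ∀ {k} → n ≤ suc k → n / p ≤ k
    quotient≤ n≤1+k = s≤s⁻¹ (<-≤-trans (m/n<m n p {{>-nonZero 1≤n}} 1<p) n≤1+k)
  vpF-fuel zero    _    (suc _) _ () _
  vpF-fuel (suc _) zero (suc _) _ _  ()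

  Vp-multiple : ∀ q → Vp p (suc q * p) ≡ p * Vp p (suc q)
  Vp-multiple q = begin
    Vp p (suc q * p)             ≡⟨ vpF-divisible F (suc q * p) (m*n%n≡0 (suc q) p) ⟩
    p * vpF p F (suc q * p / p)  ≡⟨ cong (λ n → p * vpF p F n) (m*n/n≡m (suc q) p) ⟩
    p * vpF p F (suc q)          ≡⟨ cong (p *_) (vpF-fuel F (suc q) (suc q) (s≤s z≤n) q<F ≤-refl) ⟩
    p * Vp p (suc q)             ∎
    where
    open ≡-Reasoning
    F : ℕ
    F = suc (p' + q * p)
    q<F : suc q ≤ F
    q<F = s≤s (≤-trans (m≤m*n q p) (m≤n+m (q * p) p'))

  Vp-indivisible : ∀ q j → suc j < p → Vp p (suc j + q * p) ≡ 1
  Vp-indivisible q j 1+j<p = vpF-indivisible (j + q * p) (suc j + q * p) (λ p∣n → 0≢1+n (begin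
    0                      ≡⟨ p∣n ⟨
    (suc j + q * p) % p    ≡⟨ [m+kn]%n≡m%n (suc j) q p ⟩
    suc j % p              ≡⟨ m<n⇒m%n≡m 1+j<p ⟩
    suc j                  ∎))
    where open ≡-Reasoning

module InModel (p' : ℕ) (M : Structure) (M⊨T : ModelOfTBA (suc (suc p')) M) where
  open Structure M
  open Semantics M
  open StandardVp p'

  ℕₚ : Structure
  ℕₚ = Std p (s≤s (s≤s z≤n))

  -- The axioms are stated for the variables x = var 0 and y = var 1.
  ⟨_,_⟩ : Carrier → Carrier → Assignment M
  ⟨ a , b ⟩ zero    = a
  ⟨ a , b ⟩ (suc _) = b

  s-injective : ∀ {a b} → s a ≡ s b → a ≡ b
  s-injective {a} {b} = M⊨T _ S0 ⟨ a , b ⟩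

  z₀≢s : ∀ {a} → z₀ ≢ s a
  z₀≢s {a} = M⊨T _ S1 ⟨ a , a ⟩

  zero-or-successor : ∀ a → a ≡ z₀ ⊎ Σ Carrier (λ b → a ≡ s b)
  zero-or-successor a = M⊨T _ S2 ⟨ a , a ⟩

  add-z₀ : ∀ a → add a z₀ ≡ a
  add-z₀ a = M⊨T _ A0 ⟨ a , a ⟩

  add-s : ∀ a b → add a (s b) ≡ s (add a b)
  add-s a b = M⊨T _ A1 ⟨ a , b ⟩

  numeral-+ : ∀ m n → add (numeral m) (numeral n) ≡ numeral (m + n)
  numeral-+ m zero    = trans (add-z₀ (numeral m)) (cong numeral (sym (+-identityʳ m)))
  numeral-+ m (suc n) = trans (add-s (numeral m) (numeral n))
                              (trans (cong s (numeral-+ m n)) (cong numeral (sym (+-suc m n))))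

  numeral-injective : ∀ {m n} → numeral m ≡ numeral n → m ≡ n
  numeral-injective {zero}  {zero}  _ = refl
  numeral-injective {zero}  {suc n} e = ⊥-elim (z₀≢s e)
  numeral-injective {suc m} {zero}  e = ⊥-elim (z₀≢s (sym e))
  numeral-injective {suc m} {suc n} e = cong suc (numeral-injective (s-injective e))

  +≡numeral⇒numeral : ∀ N a c → add a c ≡ numeral N → Σ ℕ (λ k → a ≡ numeral k)
  +≡numeral⇒numeral N a c a+c≡N with zero-or-successor c
  ... | inj₁ refl = N , trans (sym (add-z₀ a)) a+c≡N
  ... | inj₂ (c' , refl) with N
  ...   | zero  = ⊥-elim (z₀≢s (sym (trans (sym (add-s a c')) a+c≡N)))
  ...   | suc N = +≡numeral⇒numeral N a c' (s-injective (trans (sym (add-s a c')) a+c≡N))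

  eval-rep : ∀ k t m {ρ} → evalT M ρ t ≡ numeral m → evalT M ρ (rep k t) ≡ numeral (suc k * m)
  eval-rep zero    t m t≡m = trans t≡m (cong numeral (sym (+-identityʳ m)))
  eval-rep (suc k) t m t≡m =
    trans (cong₂ add (eval-rep k t m t≡m) t≡m)
          (trans (numeral-+ (suc k * m) m) (cong numeral (+-comm (suc k * m) m)))

  vp-numeral-multiple : ∀ m → vp (numeral m) ≡ numeral (Vp p m) →
                        vp (numeral (p * m)) ≡ numeral (p * Vp p m)
  vp-numeral-multiple m vp-m = begin
    vp (numeral (p * m))              ≡⟨ cong vp (eval-rep (suc p') (var 0) m refl) ⟨
    vp (evalT M ρ (times p (var 0)))  ≡⟨ M⊨T _ V2 ρ ⟩
    evalT M ρ (times p (V (var 0)))   ≡⟨ eval-rep (suc p') (V (var 0)) (Vp p m) vp-m ⟩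
    numeral (p * Vp p m)              ∎
    where
    open ≡-Reasoning
    ρ : Assignment M
    ρ = ⟨ numeral m , numeral m ⟩

  vp-numeral-indivisible : ∀ m j → j < suc p' → vp (numeral (p * m + suc j)) ≡ numeral 1
  vp-numeral-indivisible m j j<p-1 = begin
    vp (numeral (p * m + suc j))                     ≡⟨ cong vp p*m+1+j ⟨
    vp (evalT M ρ (times p (var 0) ⊕ num (suc j)))  ≡⟨ V3-at-j ⟩
    numeral 1                                        ∎
    where
    open ≡-Reasoning
    ρ : Assignment M
    ρ = ⟨ numeral m , numeral m ⟩
    V3-at-j : Sat M ρ (V (times p (var 0) ⊕ num (suc j)) ≐ num 1)
    V3-at-j = sat-⋀-applyUpTo (λ i → V (times p (var 0) ⊕ num (suc i)) ≐ num 1) (suc p') j<p-1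
                              (M⊨T _ V3 ρ)
    p*m+1+j : evalT M ρ (times p (var 0) ⊕ num (suc j)) ≡ numeral (p * m + suc j)
    p*m+1+j = trans (cong₂ add (eval-rep (suc p') (var 0) m refl) (eval-num ρ (suc j)))
                    (numeral-+ (p * m) (suc j))

  vp-numeral : ∀ n → vp (numeral n) ≡ numeral (Vp p n)
  vp-numeral = <-rec _ λ n ih → by-p-adic-digit ih (n divMod p)
    where
    by-p-adic-digit : ∀ {n} → (∀ {m} → m < n → vp (numeral m) ≡ numeral (Vp p m)) →
                      DivMod n p → vp (numeral n) ≡ numeral (Vp p n)
    by-p-adic-digit ih (result zero    Fin.zero refl) = M⊨T _ V0 ⟨ z₀ , z₀ ⟩
    by-p-adic-digit ih (result (suc q) Fin.zero refl) = begin
      vp (numeral (suc q * p))   ≡⟨ cong (vp ∘ numeral) (*-comm (suc q) p) ⟩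
      vp (numeral (p * suc q))   ≡⟨ vp-numeral-multiple (suc q) (ih (m<m*n (suc q) p 1<p)) ⟩
      numeral (p * Vp p (suc q)) ≡⟨ cong numeral (Vp-multiple q) ⟨
      numeral (Vp p (suc q * p)) ∎
      where open ≡-Reasoning
    by-p-adic-digit ih (result q (Fin.suc j) refl) = begin
      vp (numeral (suc (toℕ j) + q * p))  ≡⟨ cong (vp ∘ numeral) (+-comm (suc (toℕ j)) (q * p)) ⟩
      vp (numeral (q * p + suc (toℕ j)))  ≡⟨ cong (λ n → vp (numeral (n + suc (toℕ j)))) (*-comm q p) ⟩
      vp (numeral (p * q + suc (toℕ j)))  ≡⟨ vp-numeral-indivisible q (toℕ j) (toℕ<n j) ⟩
      numeral 1                           ≡⟨ cong numeral (Vp-indivisible q (toℕ j) (s≤s (toℕ<n j))) ⟨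
      numeral (Vp p (suc (toℕ j) + q * p)) ∎
      where open ≡-Reasoning

  eval-standard : ∀ t σ {ρ} → ρ ≗ numeral ∘ σ → evalT M ρ t ≡ numeral (evalT ℕₚ σ t)
  eval-standard (var x) σ ρ≗σ = ρ≗σ x
  eval-standard zer     σ ρ≗σ = refl
  eval-standard (S t)   σ ρ≗σ = cong s (eval-standard t σ ρ≗σ)
  eval-standard (t ⊕ u) σ ρ≗σ =
    trans (cong₂ add (eval-standard t σ ρ≗σ) (eval-standard u σ ρ≗σ))
          (numeral-+ (evalT ℕₚ σ t) (evalT ℕₚ σ u))
  eval-standard (V t)   σ ρ≗σ =
    trans (cong vp (eval-standard t σ ρ≗σ)) (vp-numeral (evalT ℕₚ σ t))

  ≗-update : ∀ {ρ σ} x k → ρ ≗ numeral ∘ σ → (ρ [ x ≔ numeral k ]) ≗ numeral ∘ (σ [ x ≔ k ])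
  ≗-update x k ρ≗σ y with y ≡ᵇ x
  ... | true  = refl
  ... | false = ρ≗σ y

  -- Only the fact that the bound n_ψ is a numeral matters, not its size.
  numeral-witness : ∀ ψ x {ρ} → OneFree x ψ → Sat M ρ (∃' x ψ) →
                    Σ ℕ λ k → Sat M (ρ [ x ≔ numeral k ]) ψ
  numeral-witness ψ x {ρ} one ψ∃ =
    let b , (c , b+c≡N) , ψb = M⊨T _ (Bound ψ x one) ρ ψ∃
        k , b≡k = +≡numeral⇒numeral N b c (sum-of-lookups b c b+c≡N)
    in  k , subst (λ a → Sat M (ρ [ x ≔ a ]) ψ) b≡k ψb
    where
    N z : ℕ
    N = nBound p ψ
    z = suc (x ⊔ maxVar ψ)
    sum-of-lookups : ∀ b c → let ρ' = ρ [ x ≔ b ] [ z ≔ c ] in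
                     add (ρ' x) (ρ' z) ≡ evalT M ρ' (num N) → add b c ≡ numeral N
    sum-of-lookups b c b+c≡N = begin
      add b c             ≡⟨ cong₂ add b-at-x (update-same (ρ [ x ≔ b ]) z c) ⟨
      add (ρ' x) (ρ' z)   ≡⟨ b+c≡N ⟩
      evalT M ρ' (num N)  ≡⟨ eval-num ρ' N ⟩
      numeral N           ∎
      where
      open ≡-Reasoning
      ρ' : Assignment M
      ρ' = ρ [ x ≔ b ] [ z ≔ c ]
      b-at-x : ρ' x ≡ b
      b-at-x = trans (update-other (ρ [ x ≔ b ]) c (<⇒≢ (s≤s (m≤m⊔n x (maxVar ψ)))))
                     (update-same ρ x b)

  standard-witness : ∀ φ x σ {ρ} → ρ ≗ numeral ∘ σ → Sat M ρ (∃' x φ) →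
                     Σ ℕ λ k → Sat M (ρ [ x ≔ numeral k ]) φ
  standard-witness φ x σ {ρ} ρ≗σ (a , φa) =
    let k , φk , _ = numeral-witness (isolate x σ φ) x {ρ} (oneFree-isolate φ x σ)
                                     (a , from (sat-closeBut φ x σ a ρ≗σ) φa , refl)
    in  k , to (sat-closeBut φ x σ (numeral k) ρ≗σ) φk

  module _ (dne : DoubleNegationElimination 0ℓ) where

    transfer : ∀ φ {ρ σ} → ρ ≗ numeral ∘ σ → Sat M ρ φ ⇔ Sat ℕₚ σ φ
    transfer (t ≐ u) {σ = σ} ρ≗σ rewrite eval-standard t σ ρ≗σ | eval-standard u σ ρ≗σ =
      mk⇔ numeral-injective (cong numeral)
    transfer (¬' φ)   ρ≗σ = ¬-cong-⇔ (transfer φ ρ≗σ)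
    transfer (φ ∧' ψ) ρ≗σ = transfer φ ρ≗σ ×-⇔ transfer ψ ρ≗σ
    transfer (φ ∨' ψ) ρ≗σ = transfer φ ρ≗σ ⊎-⇔ transfer ψ ρ≗σ
    transfer (φ ⇒' ψ) ρ≗σ = →-cong-⇔ (transfer φ ρ≗σ) (transfer ψ ρ≗σ)
    -- The classical step: a counterexample in M would have a numeral counterexample.
    transfer (∀' x φ) {σ = σ} ρ≗σ = mk⇔
      (λ φ∀ k → to (transfer φ (≗-update x k ρ≗σ)) (φ∀ (numeral k)))
      (λ φℕ a → dne λ ¬φa →
        let k , ¬φk = standard-witness (¬' φ) x σ ρ≗σ (a , ¬φa)
        in  ¬φk (from (transfer φ (≗-update x k ρ≗σ)) (φℕ k)))
    transfer (∃' x φ) {σ = σ} ρ≗σ = mk⇔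
      (λ φ∃ → let k , φk = standard-witness φ x σ ρ≗σ φ∃
              in  k , to (transfer φ (≗-update x k ρ≗σ)) φk)
      (λ (k , φk) → numeral k , from (transfer φ (≗-update x k ρ≗σ)) φk)

theorem5 : ExcludedMiddle 0ℓ → (p : ℕ) (hp : 2 ≤ p) (φ : Formula) → Sentence φ →
           _⊨_ (Std p hp) φ →
           (M : Structure) → ModelOfTBA p M → _⊨_ M φ
theorem5 em (suc (suc p')) (s≤s (s≤s z≤n)) φ closed ℕ⊨φ M M⊨T ρ =
  sentence-sat φ closed ρ (from (transfer (em⇒dne em) φ {ρ = const z₀} λ _ → refl) (ℕ⊨φ (const 0)))
  where
  open Structure M using (z₀)
  open Semantics M
  open InModel p' M M⊨T
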